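{- On the one-dimensional lattice, the charge(3) model and the even model both have growth rate equal to the golden ratio: $$\kappa_{\mathrm{charge}(3)}=\kappa_{\mathrm{even}}=\frac{1+\sqrt5}{2}.$$
   Context: In one dimension, a charge(3) configuration of length $N$ is a sequence $(s_1,\dots,s_N)\in\{+1,-1\}^N$ such that every contiguous block sum $s_j+s_{j+1}+\dots+s_k$ ($1\le j\le k\le N$) lies in $[-3,3]$. An even configuration of length $N$ is a sequence in $\{\oplus,\ominus\}^N$ such that between any two $\ominus$ entries with no $\ominus$ between them, there is an even number of $\oplus$ entries. For each model the growth rate is $\kappa=\lim_{N\to\infty} Z_N^{1/N}$, where $Z_N$ is the number of configurations of length $N$. -}

module Defs where

open import Data.Nat as ℕ using (ℕ; zero; suc; _+_; _*_; _^_; _∸_)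
open import Data.Nat.Divisibility using (_∣_; _∣?_)
open import Data.Integer as ℤ using (ℤ; +_; -[1+_])
import Data.Integer.Properties as ℤP
open import Data.Fin using (Fin; toℕ)
import Data.Fin.Properties as FinP
open import Data.Vec.Functional using (Vector) renaming (_∷_ to _◂_)
open import Data.List using (List; []; _∷_; length; filter; concatMap)
open import Data.Product using (_×_; _,_; ∃-syntax)
open import Relation.Binary.PropositionalEquality using (_≡_; refl)
open import Relation.Nullary using (Dec; yes; no)
open import Relation.Nullary.Decidable using (_×-dec_; _→-dec_)

data Sign : Set where
  ⊕ ⊖ : Sign

_≟ˢ_ : (a b : Sign) → Dec (a ≡ b)
⊕ ≟ˢ ⊕ = yes refl
⊕ ≟ˢ ⊖ = no (λ ())
⊖ ≟ˢ ⊕ = no (λ ())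
⊖ ≟ˢ ⊖ = yes refl

val : Sign → ℤ
val ⊕ = + 1
val ⊖ = -[1+ 0 ]

-- A configuration of length N: s : Fin N → Sign  (s_1 … s_N, 0-indexed).
Config : ℕ → Set
Config N = Vector Sign N

allConfigs : (N : ℕ) → List (Config N)
allConfigs zero = (λ ()) ∷ []
allConfigs (suc N) = concatMap (λ s → (⊕ ◂ s) ∷ (⊖ ◂ s) ∷ []) (allConfigs N)

sumFin : {n : ℕ} → (Fin n → ℤ) → ℤ
sumFin {zero} f = + 0
sumFin {suc n} f = f Fin.zero ℤ.+ sumFin (λ i → f (Fin.suc i))
  where import Data.Fin as Fin

blockSum : {N : ℕ} → Config N → Fin N → Fin N → ℤ
blockSum s j k = sumFin (λ i → inRange i)
  where
  inRange : _ → ℤ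
  inRange i with j FinP.≤? i | i FinP.≤? k
  ... | yes _ | yes _ = val (s i)
  ... | _     | _     = + 0

Charge3 : (N : ℕ) → Config N → Set
Charge3 N s = ∀ (j k : Fin N) → j Data.Fin.≤ k →
  (ℤ.- (+ 3) ℤ.≤ blockSum s j k) × (blockSum s j k ℤ.≤ + 3)
  where import Data.Fin

-- even configuration: between two ⊖ entries with no ⊖ between them,
-- the number of ⊕ entries (= j - i - 1) is even
Even : (N : ℕ) → Config N → Set
Even N s = ∀ (i j : Fin N) → i Data.Fin.< j → s i ≡ ⊖ → s j ≡ ⊖ →
  (∀ (m : Fin N) → i Data.Fin.< m → m Data.Fin.< j → s m ≡ ⊕) →
  2 ∣ (toℕ j ∸ toℕ i ∸ 1)
  where import Data.Fin

charge3? : (N : ℕ) → (s : Config N) → Dec (Charge3 N s)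
charge3? N s = FinP.all? λ j → FinP.all? λ k →
  (j FinP.≤? k) →-dec ((ℤ.- (+ 3) ℤP.≤? blockSum s j k) ×-dec (blockSum s j k ℤP.≤? + 3))

even? : (N : ℕ) → (s : Config N) → Dec (Even N s)
even? N s = FinP.all? λ i → FinP.all? λ j →
  (i FinP.<? j) →-dec ((s i ≟ˢ ⊖) →-dec ((s j ≟ˢ ⊖) →-dec
    ((FinP.all? λ m → (i FinP.<? m) →-dec ((m FinP.<? j) →-dec (s m ≟ˢ ⊕)))
      →-dec (2 ∣? (toℕ j ∸ toℕ i ∸ 1)))))

Zcharge3 : ℕ → ℕ
Zcharge3 N = length (filter (charge3? N) (allConfigs N))

Zeven : ℕ → ℕ
Zeven N = length (filter (even? N) (allConfigs N))

-- "Z_N^{1/N} → (1+√5)/2": for all positive rationals p/q < φ < r/s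
-- (φ the positive root of x² = x + 1, so p/q < φ ⇔ p² < pq + q² and
--  r/s > φ ⇔ r² > rs + s²), eventually (p/q)^N < Z_N < (r/s)^N.
GrowthRateGolden : (ℕ → ℕ) → Set
GrowthRateGolden Z = ∀ (p q r s : ℕ) → 0 ℕ.< q → 0 ℕ.< s →
  p * p ℕ.< p * q + q * q → r * s + s * s ℕ.< r * r →
  ∃[ N₀ ] ∀ N → N₀ ℕ.≤ N → (p ^ N ℕ.< Z N * q ^ N) × (Z N * s ^ N ℕ.< r ^ N)

module Submission where

-- The proof
-- squeezes both partition functions between Fibonacci numbers,
--     F_N ≤ Z_N ≤ 4 F_{N+2},
-- and shows that every sequence squeezed in this way has growth rate φ.
--
-- * Fibonacci: for a sequence obeying the Fibonacci recurrence, a two-step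
--   induction shows that qⁿGₙ / pⁿ (resp. rⁿ / sⁿGₙ) grows at least linearly in n
--   when p/q < φ (resp. r/s > φ), so it eventually beats every constant.
-- * Counting: Z_N is the sum of an indicator over all 2ᴺ configurations; such a
--   sum splits on the first spin, and through a finite automaton reading the
--   spins it becomes a weighted count of paths in the automaton.
-- * Even model: peeling off the first spin, evenness is governed by the parity
--   of the leading ⊕-run of the tail; the resulting four-state automaton gives
--   Z_N + 1 = F_{N+3}.
-- * Charge(3) model: block sums are differences of prefix sums, so a
--   configuration is charge(3) iff its walk stays in one of the four windows
--   [−i, 3−i]; walks confined to a window are counted by Fibonacci numbers,
--   giving F_{N+2} ≤ Z_N ≤ 2F_{N+1} + 2F_{N+2}.

open import Defs
open import Data.Product using (_×_; _,_)

module Fibonacci where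

  open import Data.Nat using (ℕ; zero; suc; _+_; _*_; _^_; _≤_; _<_; z≤n; s≤s; _⊔_; NonZero)
  open import Data.Nat.Properties
  open import Data.Nat.Tactic.RingSolver using (solve-∀)
  open import Data.Product using (proj₁; ∃-syntax)
  open import Relation.Binary.PropositionalEquality using (_≡_; refl; sym; cong; subst₂)

  fib : ℕ → ℕ
  fib 0 = 0
  fib 1 = 1
  fib (suc (suc n)) = fib (suc n) + fib n

  fib-≤-suc : ∀ n → fib n ≤ fib (suc n)
  fib-≤-suc zero = z≤n
  fib-≤-suc (suc n) = m≤m+n (fib (suc n)) (fib n)

  fib-pos : ∀ n → 1 ≤ fib (suc n)
  fib-pos zero = s≤s z≤n
  fib-pos (suc n) = ≤-trans (fib-pos n) (m≤m+n (fib (suc n)) (fib n))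

  FibonacciLike : (ℕ → ℕ) → Set
  FibonacciLike G = ∀ n → G (2 + n) ≡ G (1 + n) + G n

  twoStepInduction : (P : ℕ → Set) → P 0 → P 1 → (∀ n → P n → P (1 + n) → P (2 + n)) → ∀ n → P n
  twoStepInduction P p0 p1 step n = proj₁ (pairs n)
    where
    pairs : ∀ n → P n × P (1 + n)
    pairs zero = p0 , p1
    pairs (suc n) = let (pn , pn+1) = pairs n in pn+1 , step n pn pn+1

  fibonacciLike-lower : ∀ (G : ℕ → ℕ) → FibonacciLike G → ∀ p q A →
    p * p < p * q + q * q → 2 * (p * p) ≤ A →
    1 ≤ G 0 → (A + 1) * p ≤ A * (q * G 1) →
    ∀ n → (A + n) * p ^ n ≤ A * (q ^ n * G n)
  fibonacciLike-lower G rec p q A golden A≥2p² base₀ base₁ =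
    twoStepInduction Low low₀ low₁ step
    where
    Low : ℕ → Set
    Low n = (A + n) * p ^ n ≤ A * (q ^ n * G n)
    low₀ : Low 0
    low₀ = subst₂ _≤_ (e₁ A) (e₂ A (G 0)) (*-monoʳ-≤ A base₀)
      where
      e₁ : ∀ A → A * 1 ≡ (A + 0) * 1
      e₁ = solve-∀
      e₂ : ∀ A g → A * g ≡ A * (1 * g)
      e₂ = solve-∀
    low₁ : Low 1
    low₁ = subst₂ _≤_ (e₁ A p) (e₂ A q (G 1)) base₁
      where
      e₁ : ∀ A p → (A + 1) * p ≡ (A + 1) * (p * 1)
      e₁ = solve-∀
      e₂ : ∀ A q g → A * (q * g) ≡ A * (q * 1 * g)
      e₂ = solve-∀
    step : ∀ n → Low n → Low (1 + n) → Low (2 + n)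
    step n lowₙ lowₙ₊₁ = begin
      (A + (2 + n)) * (p * (p * P))             ≡⟨ e₁ A n p P ⟩
      (A + n) * (p * (p * P)) + 2 * (p * p) * P
        ≤⟨ +-monoʳ-≤ ((A + n) * (p * (p * P))) (*-monoˡ-≤ P (≤-trans A≥2p² (m≤m+n A n))) ⟩
      (A + n) * (p * (p * P)) + (A + n) * P     ≡⟨ e₂ A n p P ⟩
      (A + n) * P * (1 + p * p)                 ≤⟨ *-monoʳ-≤ ((A + n) * P) golden ⟩
      (A + n) * P * (p * q + q * q)             ≡⟨ e₃ A n p q P ⟩
      q * ((A + n) * (p * P)) + q * q * ((A + n) * P)
        ≤⟨ +-monoˡ-≤ (q * q * ((A + n) * P)) (*-monoʳ-≤ q (*-monoˡ-≤ (p * P) (+-monoʳ-≤ A (n≤1+n n)))) ⟩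
      q * ((A + (1 + n)) * (p * P)) + q * q * ((A + n) * P)
        ≤⟨ +-mono-≤ (*-monoʳ-≤ q lowₙ₊₁) (*-monoʳ-≤ (q * q) lowₙ) ⟩
      q * (A * (q * Q * G (1 + n))) + q * q * (A * (Q * G n)) ≡⟨ e₄ A q Q (G (1 + n)) (G n) ⟩
      A * (q * (q * Q) * (G (1 + n) + G n))     ≡⟨ cong (λ g → A * (q * (q * Q) * g)) (sym (rec n)) ⟩
      A * (q * (q * Q) * G (2 + n))             ∎
      where
      open ≤-Reasoning
      P = p ^ n
      Q = q ^ n
      e₁ : ∀ A n p P → (A + (2 + n)) * (p * (p * P)) ≡ (A + n) * (p * (p * P)) + 2 * (p * p) * P
      e₁ = solve-∀
      e₂ : ∀ A n p P → (A + n) * (p * (p * P)) + (A + n) * P ≡ (A + n) * P * (1 + p * p)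
      e₂ = solve-∀
      e₃ : ∀ A n p q P → (A + n) * P * (p * q + q * q) ≡ q * ((A + n) * (p * P)) + q * q * ((A + n) * P)
      e₃ = solve-∀
      e₄ : ∀ A q Q g₁ g₀ → q * (A * (q * Q * g₁)) + q * q * (A * (Q * g₀)) ≡ A * (q * (q * Q) * (g₁ + g₀))
      e₄ = solve-∀

  fibonacciLike-upper : ∀ (G : ℕ → ℕ) → FibonacciLike G → ∀ r s A C → .{{_ : NonZero A}} →
    r * s + s * s < r * r → r * s + 2 * (s * s) ≤ A →
    G 0 ≤ C → (A + 1) * (s * G 1) ≤ A * (C * r) →
    ∀ n → (A + n) * (s ^ n * G n) ≤ A * (C * r ^ n)
  fibonacciLike-upper G rec r s A C golden A≥rs+2s² base₀ base₁ =
    twoStepInduction Up up₀ up₁ step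
    where
    Up : ℕ → Set
    Up n = (A + n) * (s ^ n * G n) ≤ A * (C * r ^ n)
    up₀ : Up 0
    up₀ = subst₂ _≤_ (e₁ A (G 0)) (e₂ A C) (*-monoʳ-≤ A base₀)
      where
      e₁ : ∀ A g → A * g ≡ (A + 0) * (1 * g)
      e₁ = solve-∀
      e₂ : ∀ A C → A * C ≡ A * (C * 1)
      e₂ = solve-∀
    up₁ : Up 1
    up₁ = subst₂ _≤_ (e₁ A s (G 1)) (e₂ A C r) base₁
      where
      e₁ : ∀ A s g → (A + 1) * (s * g) ≡ (A + 1) * (s * 1 * g)
      e₁ = solve-∀
      e₂ : ∀ A C r → A * (C * r) ≡ A * (C * (r * 1))
      e₂ = solve-∀
    bounded : ∀ n → Up n → s ^ n * G n ≤ C * r ^ n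
    bounded n up = *-cancelˡ-≤ A (≤-trans (*-monoˡ-≤ (s ^ n * G n) (m≤m+n A n)) up)
    step : ∀ n → Up n → Up (1 + n) → Up (2 + n)
    step n upₙ upₙ₊₁ = begin
      (A + (2 + n)) * (s * (s * S) * G (2 + n))   ≡⟨ cong (λ g → (A + (2 + n)) * (s * (s * S) * g)) (rec n) ⟩
      (A + (2 + n)) * (s * (s * S) * (g₁ + g₀))  ≡⟨ e₁ A n s S g₁ g₀ ⟩
      s * ((A + (1 + n)) * (s * S * g₁)) + s * s * ((A + n) * (S * g₀))
        + (s * (s * S * g₁) + 2 * (s * s) * (S * g₀))
        ≤⟨ +-mono-≤ (+-mono-≤ (*-monoʳ-≤ s upₙ₊₁) (*-monoʳ-≤ (s * s) upₙ))
                    (+-mono-≤ (*-monoʳ-≤ s (bounded (1 + n) upₙ₊₁)) (*-monoʳ-≤ (2 * (s * s)) (bounded n upₙ))) ⟩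
      s * (A * (C * (r * R))) + s * s * (A * (C * R)) + (s * (C * (r * R)) + 2 * (s * s) * (C * R))
        ≡⟨ e₂ A C r s R ⟩
      A * (C * R) * (r * s + s * s) + (r * s + 2 * (s * s)) * (C * R)
        ≤⟨ +-monoʳ-≤ (A * (C * R) * (r * s + s * s)) (*-monoˡ-≤ (C * R) A≥rs+2s²) ⟩
      A * (C * R) * (r * s + s * s) + A * (C * R) ≡⟨ e₃ A C R (r * s + s * s) ⟩
      A * (C * R) * (1 + (r * s + s * s))         ≤⟨ *-monoʳ-≤ (A * (C * R)) golden ⟩
      A * (C * R) * (r * r)                       ≡⟨ e₄ A C R r ⟩
      A * (C * (r * (r * R)))                     ∎
      where
      open ≤-Reasoning
      S = s ^ n
      R = r ^ n
      g₁ = G (1 + n)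
      g₀ = G n
      e₁ : ∀ A n s S g₁ g₀ → (A + (2 + n)) * (s * (s * S) * (g₁ + g₀))
        ≡ s * ((A + (1 + n)) * (s * S * g₁)) + s * s * ((A + n) * (S * g₀))
          + (s * (s * S * g₁) + 2 * (s * s) * (S * g₀))
      e₁ = solve-∀
      e₂ : ∀ A C r s R → s * (A * (C * (r * R))) + s * s * (A * (C * R)) + (s * (C * (r * R)) + 2 * (s * s) * (C * R))
        ≡ A * (C * R) * (r * s + s * s) + (r * s + 2 * (s * s)) * (C * R)
      e₂ = solve-∀
      e₃ : ∀ A C R x → A * (C * R) * x + A * (C * R) ≡ A * (C * R) * (1 + x)
      e₃ = solve-∀
      e₄ : ∀ A C R r → A * (C * R) * (r * r) ≡ A * (C * (r * (r * R)))
      e₄ = solve-∀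

  -- Below φ the Fibonacci numbers win: if p/q < φ then pᴺ < Fᴺ qᴺ for large N.
  -- (For p = 0 this is F_N qᴺ > 0.)  Otherwise apply the lower growth lemma to
  -- Gₙ = D·F_{n+1} with D = 2p + 1, whose first two instances then hold for
  -- A = 2p² + 1; once n ≥ ADp the linear factor A + n beats the constant ADp.
  fib-beats-below-golden : ∀ p q → 0 < q → p * p < p * q + q * q →
    ∃[ N₀ ] ∀ N → N₀ ≤ N → p ^ N < fib N * q ^ N
  fib-beats-below-golden zero q@(suc _) _ _ = 1 , λ { (suc n) _ → *-mono-≤ (fib-pos n) (m^n>0 q (suc n)) }
  fib-beats-below-golden p@(suc _) q@(suc _) _ golden = suc (A * D * p) , eventually
    where
    A = suc (2 * (p * p))
    D = suc (2 * p)
    G : ℕ → ℕ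
    G n = D * fib (1 + n)
    -- the second instance, G₁ = D·F₂ = D
    base₁ : (A + 1) * p ≤ A * (q * (D * 1))
    base₁ = begin
      (A + 1) * p      ≡⟨ e₁ A p ⟩
      A * p + p        ≤⟨ +-monoʳ-≤ (A * p) (m≤n*m p A) ⟩
      A * p + A * p    ≤⟨ m≤n+m (A * p + A * p) A ⟩
      A + (A * p + A * p) ≡⟨ e₂ A p ⟩
      A * D * 1        ≤⟨ *-monoʳ-≤ (A * D) (s≤s z≤n) ⟩
      A * D * q        ≡⟨ e₃ A D q ⟩
      A * (q * (D * 1)) ∎
      where
      open ≤-Reasoning
      e₁ : ∀ A p → (A + 1) * p ≡ A * p + p
      e₁ = solve-∀
      e₂ : ∀ A p → A + (A * p + A * p) ≡ A * (1 + 2 * p) * 1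
      e₂ = solve-∀
      e₃ : ∀ A D q → A * D * q ≡ A * (q * (D * 1))
      e₃ = solve-∀
    lower : ∀ n → (A + n) * p ^ n ≤ A * (q ^ n * G n)
    lower = fibonacciLike-lower G (λ n → *-distribˡ-+ D (fib (2 + n)) (fib (1 + n))) p q A golden
      (n≤1+n _) (s≤s z≤n) base₁
    eventually : ∀ N → suc (A * D * p) ≤ N → p ^ N < fib N * q ^ N
    eventually (suc n) (s≤s ADp≤n) = *-cancelˡ-< (A * D) _ _ (begin-strict
      A * D * (p * p ^ n)               ≡⟨ e₁ (A * D) p (p ^ n) ⟩
      A * D * p * p ^ n
        <⟨ *-monoˡ-< (p ^ n) {{m^n≢0 p n}} (≤-<-trans ADp≤n (m<n+m n {A} (s≤s z≤n))) ⟩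
      (A + n) * p ^ n                   ≤⟨ lower n ⟩
      A * (q ^ n * (D * fib (suc n)))   ≡⟨ e₂ A D (q ^ n) (fib (suc n)) ⟩
      A * D * (fib (suc n) * q ^ n)     ≤⟨ *-monoʳ-≤ (A * D) (*-monoʳ-≤ (fib (suc n)) (m≤n*m (q ^ n) q)) ⟩
      A * D * (fib (suc n) * (q * q ^ n)) ∎)
      where
      open ≤-Reasoning
      e₁ : ∀ x p P → x * (p * P) ≡ x * p * P
      e₁ = solve-∀
      e₂ : ∀ A D Q f → A * (Q * (D * f)) ≡ A * D * (f * Q)
      e₂ = solve-∀

  -- Apply the upper growth lemma to Gₙ = F_{n+2} with A = rs + 2s² + 1 and C = 4s;
  -- once N ≥ 4AC the linear factor A + N beats the constant 4AC.
  fib-loses-above-golden : ∀ r s → 0 < s → r * s + s * s < r * r →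
    ∃[ N₀ ] ∀ N → N₀ ≤ N → 4 * fib (2 + N) * s ^ N < r ^ N
  fib-loses-above-golden r@(suc _) s@(suc _) _ golden = 4 * (A * C) , eventually
    where
    A = suc (r * s + 2 * (s * s))
    C = 4 * s
    -- the second instance, G₁ = F₃ = 2
    base₁ : (A + 1) * (s * 2) ≤ A * (C * r)
    base₁ = begin
      (A + 1) * (s * 2)        ≡⟨ e₁ A s ⟩
      s * 2 * A + s * 2        ≤⟨ +-monoʳ-≤ (s * 2 * A) (m≤m*n (s * 2) A) ⟩
      s * 2 * A + s * 2 * A    ≡⟨ e₂ A s ⟩
      A * C * 1                ≤⟨ *-monoʳ-≤ (A * C) (s≤s z≤n) ⟩
      A * C * r                ≡⟨ *-assoc A C r ⟩
      A * (C * r)              ∎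
      where
      open ≤-Reasoning
      e₁ : ∀ A s → (A + 1) * (s * 2) ≡ s * 2 * A + s * 2
      e₁ = solve-∀
      e₂ : ∀ A s → s * 2 * A + s * 2 * A ≡ A * (4 * s) * 1
      e₂ = solve-∀
    upper : ∀ n → (A + n) * (s ^ n * fib (2 + n)) ≤ A * (C * r ^ n)
    upper = fibonacciLike-upper (λ n → fib (2 + n)) (λ n → refl) r s A C golden (n≤1+n _)
      (s≤s z≤n) base₁
    eventually : ∀ N → 4 * (A * C) ≤ N → 4 * fib (2 + N) * s ^ N < r ^ N
    eventually N 4AC≤N = *-cancelˡ-< (A + N) _ _ (begin-strict
      (A + N) * (4 * fib (2 + N) * s ^ N)     ≡⟨ e₁ (A + N) (fib (2 + N)) (s ^ N) ⟩
      4 * ((A + N) * (s ^ N * fib (2 + N)))   ≤⟨ *-monoʳ-≤ 4 (upper N) ⟩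
      4 * (A * (C * r ^ N))                   ≡⟨ e₂ A C (r ^ N) ⟩
      4 * (A * C) * r ^ N
        <⟨ *-monoˡ-< (r ^ N) {{m^n≢0 r N}} (≤-<-trans 4AC≤N (m<n+m N {A} (s≤s z≤n))) ⟩
      (A + N) * r ^ N                         ∎)
      where
      open ≤-Reasoning
      e₁ : ∀ x f S → x * (4 * f * S) ≡ 4 * (x * (S * f))
      e₁ = solve-∀
      e₂ : ∀ A C R → 4 * (A * (C * R)) ≡ 4 * (A * C) * R
      e₂ = solve-∀

  squeezed-golden : ∀ (Z : ℕ → ℕ) → (∀ N → fib N ≤ Z N) → (∀ N → Z N ≤ 4 * fib (2 + N)) →
    GrowthRateGolden Z
  squeezed-golden Z lower upper p q r s q>0 s>0 below above
    with fib-beats-below-golden p q q>0 below | fib-loses-above-golden r s s>0 above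
  ... | N₁ , beats | N₂ , loses = N₁ ⊔ N₂ , λ N N≥N₁⊔N₂ →
    <-≤-trans (beats N (≤-trans (m≤m⊔n N₁ N₂) N≥N₁⊔N₂)) (*-monoˡ-≤ (q ^ N) (lower N)) ,
    ≤-<-trans (*-monoˡ-≤ (s ^ N) (upper N)) (loses N (≤-trans (m≤n⊔m N₁ N₂) N≥N₁⊔N₂))

module Counting where

  open import Data.Nat using (ℕ; zero; suc; _+_; _≤_; z≤n)
  open import Data.Nat.Properties using (+-mono-≤; +-identityʳ; ≤-refl)
  open import Data.Nat.ListAction using (sum)
  open import Data.Nat.Tactic.RingSolver using (solve-∀)
  open import Data.Bool using (Bool; true; false)
  open import Data.Empty using (⊥-elim)
  open import Data.List using (List; []; _∷_; map; filter; length; concatMap)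
  open import Data.List.Properties using (map-cong)
  import Data.Fin as Fin
  open import Data.Vec.Functional using () renaming (_∷_ to _◂_)
  open import Relation.Binary.PropositionalEquality using (_≡_; refl; sym; trans; cong; cong₂; module ≡-Reasoning)
  open import Relation.Nullary using (Dec; yes; no; does; ¬_)

  fromBool : Bool → ℕ
  fromBool true = 1
  fromBool false = 0

  fromBool-does : ∀ {P : Set} (P? : Dec P) {n : ℕ} → (P → n ≡ 1) → (¬ P → n ≡ 0) → fromBool (does P?) ≡ n
  fromBool-does (yes p) ifYes _ = sym (ifYes p)
  fromBool-does (no ¬p) _ ifNo = sym (ifNo ¬p)

  fromBool-≤-does : ∀ {b : Bool} {P : Set} (P? : Dec P) → (b ≡ true → P) → fromBool b ≤ fromBool (does P?)
  fromBool-≤-does {false} _ _ = z≤n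
  fromBool-≤-does {true} (yes _) _ = ≤-refl
  fromBool-≤-does {true} (no ¬p) b⇒p = ⊥-elim (¬p (b⇒p refl))

  fromBool-does-≤ : ∀ {P : Set} (P? : Dec P) {n : ℕ} → (P → 1 ≤ n) → fromBool (does P?) ≤ n
  fromBool-does-≤ (yes p) p⇒1≤n = p⇒1≤n p
  fromBool-does-≤ (no _) _ = z≤n

  length-filter≡sum : ∀ {A : Set} {P : A → Set} (P? : ∀ x → Dec (P x)) (xs : List A) →
    length (filter P? xs) ≡ sum (map (λ x → fromBool (does (P? x))) xs)
  length-filter≡sum P? [] = refl
  length-filter≡sum P? (x ∷ xs) with does (P? x)
  ... | true = cong suc (length-filter≡sum P? xs)
  ... | false = length-filter≡sum P? xs

  sum-map-+ : ∀ {A : Set} (f g : A → ℕ) (xs : List A) →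
    sum (map (λ x → f x + g x) xs) ≡ sum (map f xs) + sum (map g xs)
  sum-map-+ f g [] = refl
  sum-map-+ f g (x ∷ xs) = trans (cong (f x + g x +_) (sum-map-+ f g xs)) (interchange (f x) (g x) _ _)
    where
    interchange : ∀ a b c d → a + b + (c + d) ≡ a + c + (b + d)
    interchange = solve-∀

  sum-map-mono : ∀ {A : Set} {f g : A → ℕ} (xs : List A) → (∀ x → f x ≤ g x) →
    sum (map f xs) ≤ sum (map g xs)
  sum-map-mono [] f≤g = ≤-refl
  sum-map-mono (x ∷ xs) f≤g = +-mono-≤ (f≤g x) (sum-map-mono xs f≤g)

  total : ∀ N → (Config N → ℕ) → ℕ
  total N f = sum (map f (allConfigs N))

  Z≡total : ∀ N {P : Config N → Set} (P? : ∀ s → Dec (P s)) →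
    length (filter P? (allConfigs N)) ≡ total N (λ s → fromBool (does (P? s)))
  Z≡total N P? = length-filter≡sum P? (allConfigs N)

  total-+ : ∀ N (f g : Config N → ℕ) → total N (λ s → f s + g s) ≡ total N f + total N g
  total-+ N f g = sum-map-+ f g (allConfigs N)

  total-cong : ∀ N {f g : Config N → ℕ} → (∀ s → f s ≡ g s) → total N f ≡ total N g
  total-cong N f≗g = cong sum (map-cong f≗g (allConfigs N))

  total-mono : ∀ N {f g : Config N → ℕ} → (∀ s → f s ≤ g s) → total N f ≤ total N g
  total-mono N = sum-map-mono (allConfigs N)

  total-suc : ∀ N (f : Config (suc N) → ℕ) →
    total (suc N) f ≡ total N (λ t → f (⊕ ◂ t)) + total N (λ t → f (⊖ ◂ t))
  total-suc N f = split (allConfigs N)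
    where
    split : (ts : List (Config N)) →
      sum (map f (concatMap (λ t → (⊕ ◂ t) ∷ (⊖ ◂ t) ∷ []) ts))
        ≡ sum (map (λ t → f (⊕ ◂ t)) ts) + sum (map (λ t → f (⊖ ◂ t)) ts)
    split [] = refl
    split (t ∷ ts) = trans (cong (λ x → f (⊕ ◂ t) + (f (⊖ ◂ t) + x)) (split ts))
      (interchange (f (⊕ ◂ t)) (f (⊖ ◂ t)) _ _)
      where
      interchange : ∀ a b c d → a + (b + (c + d)) ≡ a + c + (b + d)
      interchange = solve-∀

  total-zero : ∀ N → total N (λ _ → 0) ≡ 0
  total-zero zero = refl
  total-zero (suc N) = trans (total-suc N (λ _ → 0)) (cong₂ _+_ (total-zero N) (total-zero N))

  tail : ∀ {N} → Config (suc N) → Config N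
  tail s i = s (Fin.suc i)

  -- Counting through a deterministic automaton that reads a configuration from
  -- its last spin to its first, starting in σ₀.  `paths N h σ` sums the weight h
  -- of the states reached from σ by all 2ᴺ input words of length N.
  module Automaton {State : Set} (δ : Sign → State → State) (σ₀ : State) where

    state : ∀ {N} → Config N → State
    state {zero} _ = σ₀
    state {suc N} s = δ (s Fin.zero) (state (tail s))

    paths : ℕ → (State → ℕ) → State → ℕ
    paths zero h σ = h σ
    paths (suc N) h σ = paths N h (δ ⊕ σ) + paths N h (δ ⊖ σ)

    paths-last : ∀ N h σ → paths (suc N) h σ ≡ paths N (λ τ → h (δ ⊕ τ) + h (δ ⊖ τ)) σ
    paths-last zero h σ = refl
    paths-last (suc N) h σ = cong₂ _+_ (paths-last N h (δ ⊕ σ)) (paths-last N h (δ ⊖ σ))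

    total-state : ∀ N h → total N (λ s → h (state s)) ≡ paths N h σ₀
    total-state zero h = +-identityʳ (h σ₀)
    total-state (suc N) h = begin
      total (suc N) (λ s → h (state s))                                ≡⟨ total-suc N _ ⟩
      total N (λ t → h (δ ⊕ (state t))) + total N (λ t → h (δ ⊖ (state t)))
                                                                        ≡⟨ sym (total-+ N _ _) ⟩
      total N (λ t → h (δ ⊕ (state t)) + h (δ ⊖ (state t)))            ≡⟨ total-state N _ ⟩
      paths N (λ τ → h (δ ⊕ τ) + h (δ ⊖ τ)) σ₀                         ≡⟨ sym (paths-last N h σ₀) ⟩
      paths (suc N) h σ₀                                                ∎
      where open ≡-Reasoning

module EvenModel where

  open import Data.Nat using (ℕ; zero; suc; _+_; _*_; _≤_; z≤n; s≤s)
  open import Data.Nat.Properties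
    using (suc-injective; +-comm; +-identityʳ; +-cancelʳ-≤; +-mono-≤; +-monoʳ-≤; ≤-trans; m≤m+n; module ≤-Reasoning)
  open import Data.Nat.Divisibility using (_∣_; divides)
  open import Data.Nat.Tactic.RingSolver using (solve-∀)
  open import Data.Maybe using (Maybe; just; nothing)
  open import Data.Product using (Σ; proj₁; proj₂)
  open import Data.Sum using (_⊎_; inj₁; inj₂)
  open import Data.Empty using (⊥-elim)
  open import Data.Fin using (Fin; toℕ)
  import Data.Fin as Fin
  open import Relation.Binary.PropositionalEquality using (_≡_; _≢_; refl; sym; trans; cong; cong₂)
  open import Relation.Nullary using (¬_; yes; no; does)
  open Fibonacci
  open Counting

  -- The leading run of a configuration: it has no ⊖ at all, or its first ⊖
  -- is preceded by an even or by an odd number of ⊕.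
  data Lead : Set where
    no⊖ even odd : Lead

  flipParity : Lead → Lead
  flipParity no⊖ = no⊖
  flipParity even = odd
  flipParity odd = even

  leadStep : Sign → Lead → Lead
  leadStep ⊕ l = flipParity l
  leadStep ⊖ _ = even

  lead : ∀ {N} → Config N → Lead
  lead {zero} _ = no⊖
  lead {suc N} s = leadStep (s Fin.zero) (lead (tail s))

  -- parity of a number, as the leading run it would describe
  parity : ℕ → Lead
  parity 0 = even
  parity 1 = odd
  parity (suc (suc n)) = parity n

  parity-suc : ∀ n → parity (suc n) ≡ flipParity (parity n)
  parity-suc 0 = refl
  parity-suc 1 = refl
  parity-suc (suc (suc n)) = parity-suc n

  parity-even : ∀ n → parity n ≡ even → 2 ∣ n
  parity-even 0 _ = divides 0 refl
  parity-even 1 ()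
  parity-even (suc (suc n)) p with parity-even n p
  ... | divides q n≡q*2 = divides (suc q) (cong (λ m → suc (suc m)) n≡q*2)

  parity-odd : ∀ n → parity n ≡ odd → ¬ 2 ∣ n
  parity-odd 0 () _
  parity-odd 1 _ (divides zero ())
  parity-odd 1 _ (divides (suc q) ())
  parity-odd (suc (suc n)) p (divides zero ())
  parity-odd (suc (suc n)) p (divides (suc q) eq) =
    parity-odd n p (divides q (suc-injective (suc-injective eq)))

  parity-dichotomy : ∀ n → parity n ≡ even ⊎ parity n ≡ odd
  parity-dichotomy 0 = inj₁ refl
  parity-dichotomy 1 = inj₂ refl
  parity-dichotomy (suc (suc n)) = parity-dichotomy n

  FirstMinus : ∀ {N} → Config N → Fin N → Set
  FirstMinus t k = t k ≡ ⊖ × (∀ m → m Fin.< k → t m ≡ ⊕)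

  first-minus-tail : ∀ {N} (s : Config (suc N)) k → s Fin.zero ≡ ⊕ → FirstMinus (tail s) k →
    FirstMinus s (Fin.suc k)
  first-minus-tail s k s₀≡⊕ (tk≡⊖ , before) = tk≡⊖ , λ
    { Fin.zero _ → s₀≡⊕
    ; (Fin.suc m) (s≤s m<k) → before m m<k }

  lead-first-minus : ∀ {N} (t : Config N) k → FirstMinus t k → lead t ≡ parity (toℕ k)
  lead-first-minus t Fin.zero (t₀≡⊖ , _) rewrite t₀≡⊖ = refl
  lead-first-minus t (Fin.suc k) (tk≡⊖ , before) rewrite before Fin.zero (s≤s z≤n) =
    trans (cong flipParity (lead-first-minus (tail t) k (tk≡⊖ , λ m m<k → before (Fin.suc m) (s≤s m<k))))
          (sym (parity-suc (toℕ k)))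

  first-minus-exists : ∀ {N} (t : Config N) → lead t ≢ no⊖ → Σ (Fin N) (FirstMinus t)
  first-minus-exists {zero} t lead≢no⊖ = ⊥-elim (lead≢no⊖ refl)
  first-minus-exists {suc N} t lead≢no⊖ with t Fin.zero in t₀
  ... | ⊖ = Fin.zero , t₀ , λ _ ()
  ... | ⊕ with first-minus-exists (tail t) (λ tail≡no⊖ → lead≢no⊖ (cong flipParity tail≡no⊖))
  ...   | k , first = Fin.suc k , first-minus-tail t k t₀ first

  odd≢no⊖ : odd ≢ no⊖
  odd≢no⊖ ()

  -- Evenness peeled off from the front: the tail is even, and a leading ⊖ must be
  -- followed by an even run of ⊕ before the next ⊖.
  -- prepending x to a configuration with leading run l creates no odd gap
  LeadOK : Sign → Lead → Set
  LeadOK x l = x ≡ ⊖ → l ≢ odd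

  even-tail : ∀ N (s : Config (suc N)) → Even (suc N) s → Even N (tail s)
  even-tail N s ev i j i<j si sj between =
    ev (Fin.suc i) (Fin.suc j) (s≤s i<j) si sj λ
      { Fin.zero () _
      ; (Fin.suc m) (s≤s i<m) (s≤s m<j) → between m i<m m<j }

  even-head : ∀ N (s : Config (suc N)) → Even (suc N) s → LeadOK (s Fin.zero) (lead (tail s))
  even-head N s ev s₀≡⊖ lead≡odd
    with first-minus-exists (tail s) (λ lead≡no⊖ → odd≢no⊖ (trans (sym lead≡odd) lead≡no⊖))
  ... | k , first@(sk≡⊖ , before) =
    parity-odd (toℕ k) (trans (sym (lead-first-minus (tail s) k first)) lead≡odd)
      (ev Fin.zero (Fin.suc k) (s≤s z≤n) s₀≡⊖ sk≡⊖ λ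
        { Fin.zero () _
        ; (Fin.suc m) _ (s≤s m<k) → before m m<k })

  even-cons : ∀ N (s : Config (suc N)) → Even N (tail s) → LeadOK (s Fin.zero) (lead (tail s)) →
    Even (suc N) s
  even-cons N s ev ok Fin.zero Fin.zero () _ _ _
  even-cons N s ev ok (Fin.suc i) Fin.zero () _ _ _
  even-cons N s ev ok (Fin.suc i) (Fin.suc j) (s≤s i<j) si sj between =
    ev i j i<j si sj λ m i<m m<j → between (Fin.suc m) (s≤s i<m) (s≤s m<j)
  even-cons N s ev ok Fin.zero (Fin.suc k) _ s₀≡⊖ sk≡⊖ between with parity-dichotomy (toℕ k)
  ... | inj₁ even-k = parity-even (toℕ k) even-k
  ... | inj₂ odd-k = ⊥-elim (ok s₀≡⊖ (trans (lead-first-minus (tail s) k first) odd-k))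
    where
    first : FirstMinus (tail s) k
    first = sk≡⊖ , λ m m<k → between (Fin.suc m) (s≤s z≤n) (s≤s m<k)

  -- The automaton recognising even configurations, read from the last spin: its
  -- state is the leading run of the part read so far, or `nothing` once a violation
  -- (a ⊖ followed by an odd run of ⊕ and another ⊖) has been seen.
  evenStep : Sign → Maybe Lead → Maybe Lead
  evenStep x nothing = nothing
  evenStep ⊕ (just l) = just (flipParity l)
  evenStep ⊖ (just no⊖) = just even
  evenStep ⊖ (just even) = just even
  evenStep ⊖ (just odd) = nothing

  evenStep-ok : ∀ x l → LeadOK x l → evenStep x (just l) ≡ just (leadStep x l)
  evenStep-ok ⊕ l _ = refl
  evenStep-ok ⊖ no⊖ _ = refl
  evenStep-ok ⊖ even _ = refl
  evenStep-ok ⊖ odd ok = ⊥-elim (ok refl refl)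

  evenStep-violation : ∀ x l → ¬ LeadOK x l → evenStep x (just l) ≡ nothing
  evenStep-violation ⊕ l notOK = ⊥-elim (notOK λ ())
  evenStep-violation ⊖ no⊖ notOK = ⊥-elim (notOK λ _ ())
  evenStep-violation ⊖ even notOK = ⊥-elim (notOK λ _ ())
  evenStep-violation ⊖ odd _ = refl

  open Automaton evenStep (just no⊖) renaming (state to classify; paths to evenPaths)

  classify-correct : ∀ N (t : Config N) →
    (Even N t → classify t ≡ just (lead t)) × (¬ Even N t → classify t ≡ nothing)
  classify-correct zero t = (λ _ → refl) , λ notEven → ⊥-elim (notEven λ ())
  classify-correct (suc N) s = accept , reject
    where
    x = s Fin.zero
    ih = classify-correct N (tail s)
    accept : Even (suc N) s → classify s ≡ just (lead s)
    accept ev = trans (cong (evenStep x) (proj₁ ih (even-tail N s ev)))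
                      (evenStep-ok x (lead (tail s)) (even-head N s ev))
    reject : ¬ Even (suc N) s → classify s ≡ nothing
    reject notEven with even? N (tail s)
    ... | no tailNotEven = cong (evenStep x) (proj₂ ih tailNotEven)
    ... | yes tailEven = trans (cong (evenStep x) (proj₁ ih tailEven))
            (evenStep-violation x (lead (tail s)) (λ ok → notEven (even-cons N s tailEven ok)))

  accepting : Maybe Lead → ℕ
  accepting nothing = 0
  accepting (just _) = 1

  indicator-even : ∀ N (s : Config N) → fromBool (does (even? N s)) ≡ accepting (classify s)
  indicator-even N s = fromBool-does (even? N s)
    (λ ev → cong accepting (proj₁ (classify-correct N s) ev))
    (λ notEven → cong accepting (proj₂ (classify-correct N s) notEven))

  Zeven≡paths : ∀ N → Zeven N ≡ evenPaths N accepting (just no⊖)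
  Zeven≡paths N = trans (Z≡total N (even? N))
    (trans (total-cong N (indicator-even N)) (total-state N accepting))

  evenPaths-closed : ∀ N →
    (evenPaths N accepting nothing ≡ 0) × (evenPaths N accepting (just odd) ≡ fib (1 + N)) ×
    (evenPaths N accepting (just even) ≡ fib (2 + N)) × (evenPaths N accepting (just no⊖) + 1 ≡ fib (3 + N))
  evenPaths-closed zero = refl , refl , refl , refl
  evenPaths-closed (suc N) with evenPaths-closed N
  ... | dead , fromOdd , fromEven , fromStart =
      cong₂ _+_ dead dead
    , trans (cong₂ _+_ fromEven dead) (+-identityʳ _)
    , trans (cong₂ _+_ fromOdd fromEven) (+-comm (fib (1 + N)) _)
    , trans (+1-comm (evenPaths N accepting (just no⊖)) _) (cong₂ _+_ fromStart fromEven)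
    where
    +1-comm : ∀ a b → a + b + 1 ≡ a + 1 + b
    +1-comm = solve-∀

  -- Z_N + 1 = F_{N+3} = F_{N+2} + F_{N+1} lies between F_N + 1 and 2F_{N+2} + 1.
  even-lower : ∀ N → fib N ≤ Zeven N
  even-lower N = +-cancelʳ-≤ 1 (fib N) (Zeven N) (begin
    fib N + 1                  ≤⟨ +-mono-≤ (≤-trans (fib-≤-suc N) (fib-≤-suc (1 + N))) (fib-pos N) ⟩
    fib (2 + N) + fib (1 + N)  ≡⟨ sym fromStart ⟩
    evenPaths N accepting (just no⊖) + 1 ≡⟨ cong (_+ 1) (sym (Zeven≡paths N)) ⟩
    Zeven N + 1                ∎)
    where
    open ≤-Reasoning
    fromStart = proj₂ (proj₂ (proj₂ (evenPaths-closed N)))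

  even-upper : ∀ N → Zeven N ≤ 4 * fib (2 + N)
  even-upper N = begin
    Zeven N                    ≤⟨ m≤m+n (Zeven N) 1 ⟩
    Zeven N + 1                ≡⟨ cong (_+ 1) (Zeven≡paths N) ⟩
    evenPaths N accepting (just no⊖) + 1 ≡⟨ fromStart ⟩
    fib (2 + N) + fib (1 + N)  ≤⟨ +-monoʳ-≤ (fib (2 + N)) (fib-≤-suc (1 + N)) ⟩
    fib (2 + N) + fib (2 + N)  ≤⟨ +-monoʳ-≤ (fib (2 + N)) (m≤m+n (fib (2 + N)) _) ⟩
    4 * fib (2 + N)            ∎
    where
    open ≤-Reasoning
    fromStart = proj₂ (proj₂ (proj₂ (evenPaths-closed N)))

-- The charge(3) model: a configuration is charge(3) iff all its prefix sums,
-- including the empty one, lie in one of four windows of width 3.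
module ChargeWindows where

  open import Data.Nat using (zero; suc; z≤n; s≤s)
  open import Data.Nat.Properties using (≤-pred)
  open import Data.Integer as ℤ using (ℤ; +_; -[1+_]; _+_; _-_; _≤_)
  import Data.Integer.Properties as ℤP
  open import Data.Integer.Tactic.RingSolver using (solve-∀)
  open import Data.Bool using (Bool; true; false)
  open import Data.Maybe using (Maybe; just; nothing; maybe)
  open import Data.Product using (Σ; proj₁; proj₂)
  open import Data.Sum using (_⊎_; inj₁; inj₂)
  open import Data.Empty using (⊥-elim)
  open import Data.Fin using (Fin)
  import Data.Fin as Fin
  import Data.Fin.Properties as FinP
  open import Function.Bundles using (_⇔_; Equivalence; mk⇔)
  open import Relation.Binary.PropositionalEquality
    using (_≡_; refl; sym; trans; cong; cong₂; subst; subst₂; module ≡-Reasoning)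
  open import Relation.Nullary using (¬_; Dec; yes; no)
  open import Relation.Nullary.Decidable using (True; toWitness)
  open Counting using (tail)

  sumFin-cong : ∀ {n} {f g : Fin n → ℤ} → (∀ i → f i ≡ g i) → sumFin f ≡ sumFin g
  sumFin-cong {zero} f≗g = refl
  sumFin-cong {suc n} f≗g = cong₂ _+_ (f≗g Fin.zero) (sumFin-cong (λ i → f≗g (Fin.suc i)))

  sumFin-zero : ∀ {n} {f : Fin n → ℤ} → (∀ i → f i ≡ + 0) → sumFin f ≡ + 0
  sumFin-zero {zero} f≗0 = refl
  sumFin-zero {suc n} f≗0 = cong₂ _+_ (f≗0 Fin.zero) (sumFin-zero (λ i → f≗0 (Fin.suc i)))

  blockSum-as-sumFin : ∀ {N} (s : Config N) j k → Σ (Fin N → ℤ) λ f → blockSum s j k ≡ sumFin f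
  blockSum-as-sumFin s j k = _ , refl

  summand : ∀ {N} → Config N → Fin N → Fin N → Fin N → ℤ
  summand s j k = proj₁ (blockSum-as-sumFin s j k)

  summand-inside : ∀ {N} (s : Config N) {j k i : Fin N} → j Fin.≤ i → i Fin.≤ k → summand s j k i ≡ val (s i)
  summand-inside s {j} {k} {i} j≤i i≤k with j FinP.≤? i | i FinP.≤? k
  ... | yes _ | yes _ = refl
  ... | no j≰i | _ = ⊥-elim (j≰i j≤i)
  ... | yes _ | no i≰k = ⊥-elim (i≰k i≤k)

  summand-before : ∀ {N} (s : Config N) {j k i} → ¬ j Fin.≤ i → summand s j k i ≡ + 0
  summand-before s {j} {k} {i} j≰i with j FinP.≤? i | i FinP.≤? k
  ... | yes j≤i | _ = ⊥-elim (j≰i j≤i)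
  ... | no _ | yes _ = refl
  ... | no _ | no _ = refl

  summand-after : ∀ {N} (s : Config N) {j k i} → ¬ i Fin.≤ k → summand s j k i ≡ + 0
  summand-after s {j} {k} {i} i≰k with j FinP.≤? i | i FinP.≤? k
  ... | _ | yes i≤k = ⊥-elim (i≰k i≤k)
  ... | yes _ | no _ = refl
  ... | no _ | no _ = refl

  summand-cong : ∀ {M N} (s : Config M) (s′ : Config N) {j k i j′ k′ i′} →
    (j Fin.≤ i ⇔ j′ Fin.≤ i′) → (i Fin.≤ k ⇔ i′ Fin.≤ k′) → s i ≡ s′ i′ →
    summand s j k i ≡ summand s′ j′ k′ i′
  summand-cong s s′ {j} {k} {i} {j′} {k′} {i′} lower upper si≡s′i′ =
    byCases (j FinP.≤? i) (i FinP.≤? k)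
    where
    open Equivalence
    byCases : Dec (j Fin.≤ i) → Dec (i Fin.≤ k) → summand s j k i ≡ summand s′ j′ k′ i′
    byCases (yes j≤i) (yes i≤k) = begin
      summand s j k i       ≡⟨ summand-inside s {j} {k} {i} j≤i i≤k ⟩
      val (s i)             ≡⟨ cong val si≡s′i′ ⟩
      val (s′ i′)           ≡⟨ summand-inside s′ {j′} {k′} {i′} (to lower j≤i) (to upper i≤k) ⟨
      summand s′ j′ k′ i′   ∎
      where open ≡-Reasoning
    byCases (no j≰i) _ = trans (summand-before s {j} {k} {i} j≰i)
      (sym (summand-before s′ {j′} {k′} {i′} (λ j′≤i′ → j≰i (from lower j′≤i′))))
    byCases (yes _) (no i≰k) = trans (summand-after s {j} {k} {i} i≰k)
      (sym (summand-after s′ {j′} {k′} {i′} (λ i′≤k′ → i≰k (from upper i′≤k′))))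

  psum : ∀ {N} → Config N → Fin N → ℤ
  psum s Fin.zero = val (s Fin.zero)
  psum s (Fin.suc k) = val (s Fin.zero) + psum (tail s) k

  suc-≤-suc : ∀ {N} {a b : Fin N} → (Fin.suc a Fin.≤ Fin.suc b) ⇔ (a Fin.≤ b)
  suc-≤-suc = mk⇔ ≤-pred s≤s

  blockSum-tail : ∀ {N} (s : Config (suc N)) j k → blockSum s (Fin.suc j) (Fin.suc k) ≡ blockSum (tail s) j k
  blockSum-tail s j k = trans
    (cong₂ _+_ (summand-before s {Fin.suc j} {Fin.suc k} {Fin.zero} λ ())
               (sumFin-cong λ i → summand-cong s (tail s) {Fin.suc j} {Fin.suc k} {Fin.suc i} {j} {k} {i}
                  suc-≤-suc suc-≤-suc refl))
    (ℤP.+-identityˡ _)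

  blockSum-prefix : ∀ {N} (s : Config (suc N)) k → blockSum s Fin.zero k ≡ psum s k
  blockSum-prefix s Fin.zero = trans
    (cong₂ _+_ (summand-inside s {Fin.zero} {Fin.zero} {Fin.zero} z≤n z≤n)
               (sumFin-zero λ i → summand-after s {Fin.zero} {Fin.zero} {Fin.suc i} λ ()))
    (ℤP.+-identityʳ _)
  blockSum-prefix {suc N} s (Fin.suc k) = cong₂ _+_
    (summand-inside s {Fin.zero} {Fin.suc k} {Fin.zero} z≤n z≤n)
    (trans (sumFin-cong λ i → summand-cong s (tail s) {Fin.zero} {Fin.suc k} {Fin.suc i} {Fin.zero} {k} {i}
                  (mk⇔ (λ _ → z≤n) (λ _ → z≤n)) suc-≤-suc refl)
           (blockSum-prefix (tail s) k))

  infix 4 _∈[_,_]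
  _∈[_,_] : ℤ → ℤ → ℤ → Set
  z ∈[ lo , hi ] = (lo ≤ z) × (z ≤ hi)

  ∈-untranslate : ∀ {lo hi} x p → x + p ∈[ lo , hi ] → p ∈[ lo - x , hi - x ]
  ∈-untranslate {lo} {hi} x p (lo≤ , ≤hi) =
    subst (lo - x ≤_) (cancel x p) (ℤP.+-monoˡ-≤ (ℤ.- x) lo≤) ,
    subst (_≤ hi - x) (cancel x p) (ℤP.+-monoˡ-≤ (ℤ.- x) ≤hi)
    where
    cancel : ∀ x p → x + p - x ≡ p
    cancel = solve-∀

  ∈-translate : ∀ {lo hi} x p → p ∈[ lo - x , hi - x ] → x + p ∈[ lo , hi ]
  ∈-translate {lo} {hi} x p (lo≤ , ≤hi) =
    subst (_≤ x + p) (cancel x lo) (ℤP.+-monoʳ-≤ x lo≤) ,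
    subst (x + p ≤_) (cancel x hi) (ℤP.+-monoʳ-≤ x ≤hi)
    where
    cancel : ∀ x a → x + (a - x) ≡ a
    cancel = solve-∀

  Bounded3 : ℤ → Set
  Bounded3 z = z ∈[ ℤ.- (+ 3) , + 3 ]

  charge-tail : ∀ N (s : Config (suc N)) → Charge3 (suc N) s → Charge3 N (tail s)
  charge-tail N s ch j k j≤k = subst Bounded3 (blockSum-tail s j k) (ch (Fin.suc j) (Fin.suc k) (s≤s j≤k))

  charge-prefix : ∀ N (s : Config (suc N)) → Charge3 (suc N) s → ∀ k → Bounded3 (psum s k)
  charge-prefix N s ch k = subst Bounded3 (blockSum-prefix s k) (ch Fin.zero k z≤n)

  charge-cons : ∀ N (s : Config (suc N)) → Charge3 N (tail s) → (∀ k → Bounded3 (psum s k)) →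
    Charge3 (suc N) s
  charge-cons N s ch prefix Fin.zero k _ = subst Bounded3 (sym (blockSum-prefix s k)) (prefix k)
  charge-cons N s ch prefix (Fin.suc j) (Fin.suc k) (s≤s j≤k) =
    subst Bounded3 (sym (blockSum-tail s j k)) (ch j k j≤k)

  Window : ∀ {N} → Config N → ℤ → ℤ → Set
  Window t lo hi = (+ 0 ∈[ lo , hi ]) × (∀ k → psum t k ∈[ lo , hi ])

  window-tail : ∀ {N} (s : Config (suc N)) {lo hi} → Window s lo hi →
    Window (tail s) (lo - val (s Fin.zero)) (hi - val (s Fin.zero))
  window-tail s {lo} {hi} (_ , prefix) =
    ∈-untranslate x (+ 0) (subst (_∈[ lo , hi ]) (sym (ℤP.+-identityʳ x)) (prefix Fin.zero)) ,
    λ k → ∈-untranslate x (psum (tail s) k) (prefix (Fin.suc k))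
    where x = val (s Fin.zero)

  window-cons : ∀ {N} (s : Config (suc N)) {lo hi} → + 0 ∈[ lo , hi ] →
    Window (tail s) (lo - val (s Fin.zero)) (hi - val (s Fin.zero)) → Window s lo hi
  window-cons s {lo} {hi} 0∈ (0∈′ , prefix) = 0∈ , λ
    { Fin.zero → subst (_∈[ lo , hi ]) (ℤP.+-identityʳ x) (∈-translate x (+ 0) 0∈′)
    ; (Fin.suc k) → ∈-translate x (psum (tail s) k) (prefix k) }
    where x = val (s Fin.zero)

  window-combine : ∀ {N} (t : Config N) {lo₁ hi₁ lo₂ hi₂ lo hi} → Window t lo₁ hi₁ →
    (∀ k → psum t k ∈[ lo₂ , hi₂ ]) → + 0 ∈[ lo , hi ] →
    (lo ≤ lo₁ ⊎ lo ≤ lo₂) → (hi₁ ≤ hi ⊎ hi₂ ≤ hi) → Window t lo hi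
  window-combine t (_ , in₁) in₂ 0∈ lower upper = 0∈ , λ k → below k lower , above k upper
    where
    below : ∀ k → _ ⊎ _ → _
    below k (inj₁ lo≤lo₁) = ℤP.≤-trans lo≤lo₁ (proj₁ (in₁ k))
    below k (inj₂ lo≤lo₂) = ℤP.≤-trans lo≤lo₂ (proj₁ (in₂ k))
    above : ∀ k → _ ⊎ _ → _
    above k (inj₁ hi₁≤hi) = ℤP.≤-trans (proj₂ (in₁ k)) hi₁≤hi
    above k (inj₂ hi₂≤hi) = ℤP.≤-trans (proj₂ (in₂ k)) hi₂≤hi

  -- The four windows of width 3 containing 0: oᵢ is [−i, 3−i].
  data Offset : Set where
    o₀ o₁ o₂ o₃ : Offset

  low : Offset → ℤ
  low o₀ = + 0
  low o₁ = -[1+ 0 ]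
  low o₂ = -[1+ 1 ]
  low o₃ = -[1+ 2 ]

  high : Offset → ℤ
  high o₀ = + 3
  high o₁ = + 2
  high o₂ = + 1
  high o₃ = + 0

  le! : ∀ {x y : ℤ} {pf : True (x ℤP.≤? y)} → x ≤ y
  le! {pf = pf} = toWitness pf

  origin : ∀ o → + 0 ∈[ low o , high o ]
  origin o₀ = le! , le!
  origin o₁ = le! , le!
  origin o₂ = le! , le!
  origin o₃ = le! , le!

  bounded : ∀ o {z} → z ∈[ low o , high o ] → Bounded3 z
  bounded o₀ (lo≤ , ≤hi) = ℤP.≤-trans le! lo≤ , ℤP.≤-trans ≤hi le!
  bounded o₁ (lo≤ , ≤hi) = ℤP.≤-trans le! lo≤ , ℤP.≤-trans ≤hi le!
  bounded o₂ (lo≤ , ≤hi) = ℤP.≤-trans le! lo≤ , ℤP.≤-trans ≤hi le!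
  bounded o₃ (lo≤ , ≤hi) = ℤP.≤-trans le! lo≤ , ℤP.≤-trans ≤hi le!

  -- The window seen by the tail after the first spin x: shifted by −x, which
  -- is again one of the four windows unless it no longer contains 0.
  move : Sign → Offset → Maybe Offset
  move ⊕ o₀ = just o₁
  move ⊕ o₁ = just o₂
  move ⊕ o₂ = just o₃
  move ⊕ o₃ = nothing
  move ⊖ o₀ = nothing
  move ⊖ o₁ = just o₀
  move ⊖ o₂ = just o₁
  move ⊖ o₃ = just o₂

  move-just : ∀ x o {o′} → move x o ≡ just o′ → (low o - val x ≡ low o′) × (high o - val x ≡ high o′)
  move-just ⊕ o₀ refl = refl , refl
  move-just ⊕ o₁ refl = refl , refl
  move-just ⊕ o₂ refl = refl , refl
  move-just ⊖ o₁ refl = refl , refl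
  move-just ⊖ o₂ refl = refl , refl
  move-just ⊖ o₃ refl = refl , refl

  move-nothing : ∀ x o → move x o ≡ nothing → ¬ (+ 0 ∈[ low o - val x , high o - val x ])
  move-nothing ⊕ o₃ refl (_ , ())
  move-nothing ⊖ o₀ refl (ℤ.+≤+ () , _)

  window-step : ∀ {N} (s : Config (suc N)) o → Window s (low o) (high o) →
    Σ Offset λ o′ → move (s Fin.zero) o ≡ just o′ × Window (tail s) (low o′) (high o′)
  window-step s o w with move (s Fin.zero) o in eq
  ... | just o′ = o′ , refl , subst₂ (Window (tail s)) lows highs (window-tail s w)
    where
    lows = proj₁ (move-just (s Fin.zero) o eq)
    highs = proj₂ (move-just (s Fin.zero) o eq)
  ... | nothing = ⊥-elim (move-nothing (s Fin.zero) o eq (proj₁ (window-tail s w)))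

  window-unstep : ∀ {N} (s : Config (suc N)) o {o′} → move (s Fin.zero) o ≡ just o′ →
    Window (tail s) (low o′) (high o′) → Window s (low o) (high o)
  window-unstep s o eq w = window-cons s (origin o)
    (subst₂ (Window (tail s)) (sym (proj₁ (move-just (s Fin.zero) o eq))) (sym (proj₂ (move-just (s Fin.zero) o eq))) w)

  fits : ∀ {N} → Offset → Config N → Bool
  fits {zero} o t = true
  fits {suc N} o s = maybe (λ o′ → fits o′ (tail s)) false (move (s Fin.zero) o)

  fits-correct : ∀ {N} o (t : Config N) → fits o t ≡ true ⇔ Window t (low o) (high o)
  fits-correct {zero} o t = mk⇔ (λ _ → origin o , λ ()) (λ _ → refl)
  fits-correct {suc N} o s = mk⇔ sound complete
    where
    sound : fits o s ≡ true → Window s (low o) (high o)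
    sound fits≡true with move (s Fin.zero) o in eq
    ... | just o′ = window-unstep s o eq (Equivalence.to (fits-correct o′ (tail s)) fits≡true)
    complete : Window s (low o) (high o) → fits o s ≡ true
    complete w with window-step s o w
    ... | o′ , eq , w′ rewrite eq = Equivalence.from (fits-correct o′ (tail s)) w′

  -- In each case every bound of the new
  -- window is covered either by the old window or by the prefix bounds.
  extend : ∀ {N} (t : Config N) x o → Window t (low o) (high o) →
    (∀ k → psum t k ∈[ ℤ.- (+ 3) - val x , + 3 - val x ]) →
    Σ Offset λ o′ → Window t (low o′ - val x) (high o′ - val x)
  extend t ⊕ o₀ w b = o₀ , window-combine t w b (le! , le!) (inj₁ le!) (inj₂ le!)
  extend t ⊕ o₁ w b = o₀ , window-combine t w b (le! , le!) (inj₁ le!) (inj₁ le!)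
  extend t ⊕ o₂ w b = o₁ , window-combine t w b (le! , le!) (inj₁ le!) (inj₁ le!)
  extend t ⊕ o₃ w b = o₂ , window-combine t w b (le! , le!) (inj₁ le!) (inj₁ le!)
  extend t ⊖ o₀ w b = o₁ , window-combine t w b (le! , le!) (inj₁ le!) (inj₁ le!)
  extend t ⊖ o₁ w b = o₂ , window-combine t w b (le! , le!) (inj₁ le!) (inj₁ le!)
  extend t ⊖ o₂ w b = o₃ , window-combine t w b (le! , le!) (inj₁ le!) (inj₁ le!)
  extend t ⊖ o₃ w b = o₃ , window-combine t w b (le! , le!) (inj₂ le!) (inj₁ le!)

  charge⇔window : ∀ N (t : Config N) → Charge3 N t ⇔ Σ Offset λ o → Window t (low o) (high o)
  charge⇔window zero t = mk⇔ (λ _ → o₀ , origin o₀ , λ ()) (λ _ ())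
  charge⇔window (suc N) s = mk⇔ to from
    where
    x = s Fin.zero
    ih = charge⇔window N (tail s)
    to : Charge3 (suc N) s → Σ Offset λ o → Window s (low o) (high o)
    to ch with Equivalence.to ih (charge-tail N s ch)
    ... | o , w with extend (tail s) x o w
                       (λ k → ∈-untranslate (val x) (psum (tail s) k) (charge-prefix N s ch (Fin.suc k)))
    ...   | o′ , w′ = o′ , window-cons s (origin o′) w′
    from : Σ Offset (λ o → Window s (low o) (high o)) → Charge3 (suc N) s
    from (o , w) with window-step s o w
    ... | o′ , _ , w′ = charge-cons N s (Equivalence.from ih (o′ , w′)) (λ k → bounded o (proj₂ w k))

module ChargeCounting where

  open import Data.Nat using (ℕ; zero; suc; _+_; _*_; _≤_)
  open import Data.Nat.Properties
    using (≤-trans; ≤-reflexive; m≤m+n; m≤n+m; +-identityʳ; +-comm; +-mono-≤; +-monoʳ-≤; module ≤-Reasoning)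
  open import Data.Nat.Tactic.RingSolver using (solve-∀)
  open import Data.Bool using (true)
  open import Data.Product using (proj₁; proj₂)
  open import Function.Bundles using (Equivalence)
  open import Relation.Binary.PropositionalEquality using (_≡_; refl; sym; trans; cong; cong₂)
  open import Relation.Nullary using (does)
  open Fibonacci using (fib; fib-≤-suc)
  open Counting
  open ChargeWindows using (Offset; o₀; o₁; o₂; o₃; fits; fits-correct; charge⇔window)

  fitCount : ℕ → Offset → ℕ
  fitCount N o = total N (λ t → fromBool (fits o t))

  -- Walks on a path of four sites: F_{N+1} from an end site, F_{N+2} from an inner one.
  fitCount-closed : ∀ N →
    (fitCount N o₀ ≡ fib (1 + N)) × (fitCount N o₁ ≡ fib (2 + N)) ×
    (fitCount N o₂ ≡ fib (2 + N)) × (fitCount N o₃ ≡ fib (1 + N))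
  fitCount-closed zero = refl , refl , refl , refl
  fitCount-closed (suc N) with fitCount-closed N
  ... | c₀ , c₁ , c₂ , c₃ =
      trans (total-suc N _) (trans (cong₂ _+_ c₁ (total-zero N)) (+-identityʳ _))
    , trans (total-suc N _) (cong₂ _+_ c₂ c₀)
    , trans (total-suc N _) (trans (cong₂ _+_ c₃ c₁) (+-comm (fib (1 + N)) _))
    , trans (total-suc N _) (cong₂ _+_ (total-zero N) c₂)

  windowsFitted : ∀ {N} → Config N → ℕ
  windowsFitted t = fromBool (fits o₀ t) + (fromBool (fits o₁ t) + (fromBool (fits o₂ t) + fromBool (fits o₃ t)))

  fits⇒windowsFitted : ∀ {N} o (t : Config N) → fits o t ≡ true → 1 ≤ windowsFitted t
  fits⇒windowsFitted o t fits≡true = ≤-trans (≤-reflexive (cong fromBool (sym fits≡true))) (oneOf o)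
    where
    w₀ = fromBool (fits o₀ t)
    w₁ = fromBool (fits o₁ t)
    w₂ = fromBool (fits o₂ t)
    w₃ = fromBool (fits o₃ t)
    oneOf : ∀ o → fromBool (fits o t) ≤ windowsFitted t
    oneOf o₀ = m≤m+n w₀ _
    oneOf o₁ = ≤-trans (m≤m+n w₁ _) (m≤n+m _ w₀)
    oneOf o₂ = ≤-trans (m≤m+n w₂ w₃) (≤-trans (m≤n+m _ w₁) (m≤n+m _ w₀))
    oneOf o₃ = ≤-trans (m≤n+m w₃ w₂) (≤-trans (m≤n+m _ w₁) (m≤n+m _ w₀))

  -- Lower bound: the configurations fitting the window [−1, 2] are charge(3).
  charge-lower : ∀ N → fib N ≤ Zcharge3 N
  charge-lower N = begin
    fib N                ≤⟨ ≤-trans (fib-≤-suc N) (fib-≤-suc (suc N)) ⟩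
    fib (2 + N)    ≡⟨ proj₁ (proj₂ (fitCount-closed N)) ⟨
    fitCount N o₁        ≤⟨ total-mono N (λ t → fromBool-≤-does (charge3? N t) (λ fits≡true →
                              Equivalence.from (charge⇔window N t) (o₁ , Equivalence.to (fits-correct o₁ t) fits≡true))) ⟩
    total N (λ t → fromBool (does (charge3? N t))) ≡⟨ Z≡total N (charge3? N) ⟨
    Zcharge3 N           ∎
    where open ≤-Reasoning

  -- Upper bound: every charge(3) configuration fits one of the four windows.
  charge-upper : ∀ N → Zcharge3 N ≤ 4 * fib (2 + N)
  charge-upper N = begin
    Zcharge3 N           ≡⟨ Z≡total N (charge3? N) ⟩
    total N (λ t → fromBool (does (charge3? N t)))
      ≤⟨ total-mono N (λ t → fromBool-does-≤ (charge3? N t) λ ch →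
           let (o , w) = Equivalence.to (charge⇔window N t) ch
           in fits⇒windowsFitted o t (Equivalence.from (fits-correct o t) w)) ⟩
    total N windowsFitted ≡⟨ split ⟩
    fitCount N o₀ + (fitCount N o₁ + (fitCount N o₂ + fitCount N o₃))
      ≡⟨ cong₂ _+_ c₀ (cong₂ _+_ c₁ (cong₂ _+_ c₂ c₃)) ⟩
    f₁ + (f₂ + (f₂ + f₁))
      ≤⟨ +-mono-≤ f₁≤f₂ (+-monoʳ-≤ f₂ (+-monoʳ-≤ f₂ f₁≤f₂)) ⟩
    f₂ + (f₂ + (f₂ + f₂)) ≡⟨ four-times f₂ ⟩
    4 * f₂             ∎
    where
    open ≤-Reasoning
    f₁ = fib (1 + N)
    f₂ = fib (2 + N)
    f₁≤f₂ = fib-≤-suc (suc N)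
    c₀ = proj₁ (fitCount-closed N)
    c₁ = proj₁ (proj₂ (fitCount-closed N))
    c₂ = proj₁ (proj₂ (proj₂ (fitCount-closed N)))
    c₃ = proj₂ (proj₂ (proj₂ (fitCount-closed N)))
    weight : Offset → Config N → ℕ
    weight o t = fromBool (fits o t)
    split : total N windowsFitted ≡ fitCount N o₀ + (fitCount N o₁ + (fitCount N o₂ + fitCount N o₃))
    split = trans (total-+ N (weight o₀) _) (cong (fitCount N o₀ +_)
            (trans (total-+ N (weight o₁) _) (cong (fitCount N o₁ +_) (total-+ N (weight o₂) (weight o₃)))))
    four-times : ∀ f → f + (f + (f + f)) ≡ 4 * f
    four-times = solve-∀

open Fibonacci using (squeezed-golden)
open EvenModel using (even-lower; even-upper)
open ChargeCounting using (charge-lower; charge-upper)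

mainTheorem3 : GrowthRateGolden Zcharge3 × GrowthRateGolden Zeven
mainTheorem3 =
  squeezed-golden Zcharge3 charge-lower charge-upper ,
  squeezed-golden Zeven even-lower even-upper
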